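{- Let $k\geq 2$ and $n\geq k-1$. Then the vector space $W_k\subseteq \mathbb{R}[x_1,\dots,x_n]$ has dimension $M_{k-1}(n)$.
   Context: For $t\geq 1$, $M_t(n)$ denotes the number of $n$-tuples $(m_1,\dots,m_n)$ of non-negative integers with $m_1+\dots+m_n<t$. $W_k\subseteq \mathbb{R}[x_1,\dots,x_n]$ is the subspace spanned by all polynomials of the form $x_1\dotsm x_n \cdot (x_1^m+\dots+x_n^m)\cdot x_1^{2d_1}\dotsm x_n^{2d_n}$ for non-negative integers $(m,d_1,\dots,d_n)$ with $m+2(d_1+\dots+d_n)=2k-3$.
   Formalization: The coefficient field is ℚ rather than ℝ, both for the polynomial ring containing $W_k$ and for the span and the linear independence that define its dimension. -}

module Defs where

open import Data.Nat as ℕ using (ℕ; zero; suc; _∸_; _<?_)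
open import Data.Fin using (Fin; _≟_)
open import Data.Vec as Vec using (Vec; []; _∷_; lookup)
open import Data.Vec.Properties using (≡-dec)
open import Data.List as List using (List; []; _∷_; length; filter; upTo; concatMap; allFin; foldr)
import Data.List
open import Data.Product using (Σ; ∃; _×_; _,_)
open import Data.Rational using (ℚ; 0ℚ; 1ℚ; _+_; _*_)
open import Relation.Binary.PropositionalEquality using (_≡_)
open import Relation.Nullary.Decidable using (does)
open import Data.Bool using (if_then_else_)

-- M_t(n): number of n-tuples of naturals with sum < t.
-- Such tuples have all entries < t, so we enumerate all tuples with
-- entries in {0,…,t-1} and count those with sum < t.

tuples : (t n : ℕ) → List (Vec ℕ n)
tuples t zero    = [] ∷ []
tuples t (suc n) = concatMap (λ x → List.map (x ∷_) (tuples t n)) (upTo t)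

M : ℕ → ℕ → ℕ
M t n = length (filter (λ v → Vec.sum v <? t) (tuples t n))

-- Polynomials in x₁,…,xₙ with rational coefficients, as coefficient
-- functions on exponent vectors (monomial x^e ↦ coefficient).

Exp : ℕ → Set
Exp n = Vec ℕ n

Poly : ℕ → Set
Poly n = Exp n → ℚ

Σℚ : (n : ℕ) → (Fin n → ℚ) → ℚ
Σℚ n f = foldr _+_ 0ℚ (List.map f (allFin n))

mono : ∀ {n} → Exp n → Poly n
mono e f = if does (≡-dec ℕ._≟_ e f) then 1ℚ else 0ℚ

-- exponent of x₁⋯xₙ · xᵢ^m · x₁^{2d₁}⋯xₙ^{2dₙ}
expo : ∀ {n} → ℕ → Vec ℕ n → Fin n → Exp n
expo {n} m d i = Vec.tabulate λ j →
  suc (2 ℕ.* lookup d j ℕ.+ (if does (j ≟ i) then m else 0))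

-- generator x₁⋯xₙ · (x₁^m+⋯+xₙ^m) · x₁^{2d₁}⋯xₙ^{2dₙ}
gen : ∀ {n} → ℕ → Vec ℕ n → Poly n
gen {n} m d e = Σℚ n λ i → mono (expo m d i) e

GenIdx : ℕ → ℕ → Set
GenIdx k n = Σ ℕ λ m → Σ (Vec ℕ n) λ d → m ℕ.+ 2 ℕ.* Vec.sum d ≡ 2 ℕ.* k ∸ 3

genOf : ∀ {k n} → GenIdx k n → Poly n
genOf (m , d , _) = gen m d

lincomb : ∀ k {n} → List (ℚ × GenIdx k n) → Poly n
lincomb k []             e = 0ℚ
lincomb k ((c , g) ∷ cs) e = c * genOf {k} g e + lincomb k cs e

_∈W[_] : ∀ {n} → Poly n → ℕ → Set
_∈W[_] {n} P k = ∃ λ (cs : List (ℚ × GenIdx k n)) → ∀ e → P e ≡ lincomb k cs e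

combo : ∀ {n N} → (Fin N → ℚ) → (Fin N → Poly n) → Poly n
combo {N = N} c b e = Σℚ N λ i → c i * b i e

LinIndep : ∀ {n N} → (Fin N → Poly n) → Set
LinIndep {N = N} b = ∀ (c : Fin N → ℚ) → (∀ e → combo c b e ≡ 0ℚ) → ∀ i → c i ≡ 0ℚ

HasDimW : ℕ → ℕ → ℕ → Set
HasDimW k n N = Σ (Fin N → Poly n) λ b →
  (∀ i → b i ∈W[ k ]) ×
  LinIndep b ×
  (∀ P → P ∈W[ k ] → ∃ λ (c : Fin N → ℚ) → ∀ e → P e ≡ combo c b e)

{-# OPTIONS --safe #-}
module Submission where

-- Write k = s + 2. The constraint m + 2(d₁+⋯+dₙ) = 2s + 1 forces m = 2(s − |d|) + 1, so
-- the generators of W_k are indexed by the exponent vectors d with |d| ≤ s, which are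
-- counted by M_{s+1}(n). Since n > s, each such d has a zero entry i₀; in the i₀-th
-- monomial of its generator the only even exponent sits at i₀, and that monomial occurs
-- in no other generator whose m is at least as large. So the generators are
-- unitriangular with respect to m, hence linearly independent.

open import Defs
open import Data.Nat using (ℕ; _≤_; _∸_)
open import Data.Nat as ℕ using (zero; suc; _<_; _<?_)
import Data.Nat.Properties as ℕ
open import Data.Nat.Induction using (<-wellFounded)
open import Data.Fin using (Fin; zero; suc; _≟_)
open import Data.Fin.Properties using (punchInᵢ≢i)
open import Data.Vec as Vec using (Vec; []; _∷_; lookup)
import Data.Vec.Properties as Vec
open import Data.Vec.Functional using (removeAt)
open import Data.List as List using (List; []; _∷_; filter; upTo; concatMap)
import Data.List.Properties as List
open import Data.List.Membership.Propositional using (_∈_)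
open import Data.List.Membership.Propositional.Properties
  using (∈-lookup; ∈-filter⁺; ∈-filter⁻; ∈-concatMap⁺; ∈-map⁺; ∈-upTo⁺)
open import Data.List.Relation.Unary.Any as Any using (here)
open import Data.List.Relation.Unary.Any.Properties using (lookup-index)
import Data.List.Relation.Unary.All as All
open import Data.List.Relation.Unary.AllPairs using ([]; _∷_)
open import Data.List.Relation.Unary.Unique.Propositional using (Unique)
import Data.List.Relation.Unary.Unique.Propositional.Properties as Unique
open import Data.Product using (∃; _×_; _,_; proj₁; proj₂)
open import Data.Rational using (ℚ; 0ℚ; 1ℚ; _+_; _*_)
import Data.Rational.Properties as ℚ
open import Data.Bool using (if_then_else_)
open import Algebra.Bundles using (Ring)
open import Algebra.Properties.Semiring.Sum (Ring.semiring ℚ.+-*-ring)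
  using (sum; sum-cong-≗; sum-replicate-zero; sum-remove; ∑-distrib-+)
import Induction.WellFounded as WF
import Relation.Binary.Construct.On as On
open import Level using (0ℓ)
open import Function using (_∘_; id)
open import Relation.Binary.PropositionalEquality
open import Relation.Nullary using (yes; no; does; contradiction)
open import Relation.Nullary.Decidable using (dec-true; dec-false)

Σℚ≡sum : ∀ n (f : Fin n → ℚ) → Σℚ n f ≡ sum f
Σℚ≡sum n f = trans (cong (List.foldr _+_ 0ℚ) (List.map-tabulate id f)) (foldr-tabulate n f)
  where
  foldr-tabulate : ∀ n (f : Fin n → ℚ) → List.foldr _+_ 0ℚ (List.tabulate f) ≡ sum f
  foldr-tabulate zero    f = refl
  foldr-tabulate (suc n) f = cong (f zero +_) (foldr-tabulate n (f ∘ suc))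

sum-zero : ∀ {N} (f : Fin N → ℚ) → (∀ i → f i ≡ 0ℚ) → sum f ≡ 0ℚ
sum-zero {N} f f≡0 = trans (sum-cong-≗ f≡0) (sum-replicate-zero N)

sum-single : ∀ {N} (f : Fin N → ℚ) j → (∀ i → i ≢ j → f i ≡ 0ℚ) → sum f ≡ f j
sum-single {suc N} f j f≡0 = begin
  sum f                      ≡⟨ sum-remove {i = j} f ⟩
  f j + sum (removeAt f j)   ≡⟨ cong (f j +_) (sum-zero _ (λ i → f≡0 _ (punchInᵢ≢i j i))) ⟩
  f j + 0ℚ                   ≡⟨ ℚ.+-identityʳ (f j) ⟩
  f j                        ∎
  where open ≡-Reasoning

δ : ∀ {N} → Fin N → Fin N → ℚ
δ j i = if does (i ≟ j) then 1ℚ else 0ℚ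

δ-diag : ∀ {N} (j : Fin N) → δ j j ≡ 1ℚ
δ-diag j = cong (if_then 1ℚ else 0ℚ) (dec-true (j ≟ j) refl)

δ-off : ∀ {N} {i j : Fin N} → i ≢ j → δ j i ≡ 0ℚ
δ-off {i = i} {j} i≢j = cong (if_then 1ℚ else 0ℚ) (dec-false (i ≟ j) i≢j)

module _ {n N : ℕ} (b : Fin N → Poly n) where

  combo≡sum : ∀ c e → combo c b e ≡ sum (λ i → c i * b i e)
  combo≡sum c e = Σℚ≡sum N _

  combo-zero : ∀ e → combo (λ _ → 0ℚ) b e ≡ 0ℚ
  combo-zero e = trans (combo≡sum (λ _ → 0ℚ) e) (sum-zero _ (λ i → ℚ.*-zeroˡ (b i e)))

  combo-+ : ∀ c c′ e → combo (λ i → c i + c′ i) b e ≡ combo c b e + combo c′ b e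
  combo-+ c c′ e = begin
    combo (λ i → c i + c′ i) b e
      ≡⟨ combo≡sum (λ i → c i + c′ i) e ⟩
    sum (λ i → (c i + c′ i) * b i e)
      ≡⟨ sum-cong-≗ (λ i → ℚ.*-distribʳ-+ (b i e) (c i) (c′ i)) ⟩
    sum (λ i → c i * b i e + c′ i * b i e)
      ≡⟨ ∑-distrib-+ (λ i → c i * b i e) (λ i → c′ i * b i e) ⟩
    sum (λ i → c i * b i e) + sum (λ i → c′ i * b i e)
      ≡⟨ sym (cong₂ _+_ (combo≡sum c e) (combo≡sum c′ e)) ⟩
    combo c b e + combo c′ b e
      ∎
    where open ≡-Reasoning

  combo-δ : ∀ r j e → combo (λ i → r * δ j i) b e ≡ r * b j e
  combo-δ r j e = begin
    combo (λ i → r * δ j i) b e      ≡⟨ combo≡sum (λ i → r * δ j i) e ⟩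
    sum (λ i → r * δ j i * b i e)    ≡⟨ sum-single _ j off-diagonal ⟩
    r * δ j j * b j e                ≡⟨ cong (λ x → r * x * b j e) (δ-diag j) ⟩
    r * 1ℚ * b j e                   ≡⟨ cong (_* b j e) (ℚ.*-identityʳ r) ⟩
    r * b j e                        ∎
    where
    open ≡-Reasoning
    off-diagonal : ∀ i → i ≢ j → r * δ j i * b i e ≡ 0ℚ
    off-diagonal i i≢j = begin
      r * δ j i * b i e   ≡⟨ cong (λ x → r * x * b i e) (δ-off i≢j) ⟩
      r * 0ℚ * b i e      ≡⟨ cong (_* b i e) (ℚ.*-zeroʳ r) ⟩
      0ℚ * b i e          ≡⟨ ℚ.*-zeroˡ (b i e) ⟩
      0ℚ                  ∎

  unitriangular⇒linIndep : (rank : Fin N → ℕ) (pivot : Fin N → Exp n) →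
    (∀ j → b j (pivot j) ≡ 1ℚ) →
    (∀ j l → l ≢ j → rank j ≤ rank l → b l (pivot j) ≡ 0ℚ) →
    LinIndep b
  unitriangular⇒linIndep rank pivot diagonal upper c c·b≡0 =
    WF.All.wfRec (On.wellFounded rank <-wellFounded) 0ℓ (λ j → c j ≡ 0ℚ) step
    where
    step : ∀ j → (∀ {l} → rank l < rank j → c l ≡ 0ℚ) → c j ≡ 0ℚ
    step j lower≡0 = begin
      c j                                  ≡⟨ sym (ℚ.*-identityʳ (c j)) ⟩
      c j * 1ℚ                             ≡⟨ cong (c j *_) (sym (diagonal j)) ⟩
      c j * b j (pivot j)                  ≡⟨ sym (sum-single _ j other≡0) ⟩
      sum (λ l → c l * b l (pivot j))      ≡⟨ sym (combo≡sum c (pivot j)) ⟩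
      combo c b (pivot j)                  ≡⟨ c·b≡0 (pivot j) ⟩
      0ℚ                                   ∎
      where
      open ≡-Reasoning
      other≡0 : ∀ l → l ≢ j → c l * b l (pivot j) ≡ 0ℚ
      other≡0 l l≢j with rank l <? rank j
      ... | yes l<j = trans (cong (_* b l (pivot j)) (lower≡0 l<j)) (ℚ.*-zeroˡ (b l (pivot j)))
      ... | no  l≮j = trans (cong (c l *_) (upper j l l≢j (ℕ.≮⇒≥ l≮j))) (ℚ.*-zeroʳ (c l))

module _ (k : ℕ) {n N : ℕ} (b : Fin N → Poly n) where

  lincomb⇒combo : (∀ g → ∃ λ j → ∀ e → genOf {k} g e ≡ b j e) →
    ∀ cs → ∃ λ c → ∀ e → lincomb k cs e ≡ combo c b e
  lincomb⇒combo gen∈b [] = (λ _ → 0ℚ) , λ e → sym (combo-zero b e)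
  lincomb⇒combo gen∈b ((r , g) ∷ cs) with gen∈b g | lincomb⇒combo gen∈b cs
  ... | j , g≡bj | c , cs≡c = (λ i → r * δ j i + c i) , λ e → begin
    r * genOf {k} g e + lincomb k cs e
      ≡⟨ cong₂ (λ x y → r * x + y) (g≡bj e) (cs≡c e) ⟩
    r * b j e + combo c b e
      ≡⟨ cong (_+ combo c b e) (sym (combo-δ b r j e)) ⟩
    combo (λ i → r * δ j i) b e + combo c b e
      ≡⟨ sym (combo-+ b (λ i → r * δ j i) c e) ⟩
    combo (λ i → r * δ j i + c i) b e
      ∎
    where open ≡-Reasoning

genOf∈W : ∀ k {n} (g : GenIdx k n) → genOf {k} g ∈W[ k ]
genOf∈W k g = ((1ℚ , g) ∷ []) , λ e →
  sym (trans (ℚ.+-identityʳ _) (ℚ.*-identityˡ (genOf {k} g e)))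

∈-tuples : ∀ {t n} (v : Vec ℕ n) → Vec.sum v < t → v ∈ tuples t n
∈-tuples {t} {zero}  []      _  = here refl
∈-tuples {t} {suc n} (x ∷ v) lt =
  ∈-concatMap⁺ (λ y → List.map (y ∷_) (tuples t n))
    (Any.map (λ { refl → ∈-map⁺ (x ∷_) (∈-tuples v sum-v<t) }) (∈-upTo⁺ x<t))
  where
  x<t : x < t
  x<t = ℕ.≤-<-trans (ℕ.m≤m+n x (Vec.sum v)) lt
  sum-v<t : Vec.sum v < t
  sum-v<t = ℕ.≤-<-trans (ℕ.m≤n+m (Vec.sum v) x) lt

tuples-unique : ∀ t n → Unique (tuples t n)
tuples-unique t zero    = All.[] ∷ []
tuples-unique t (suc n) =
  subst Unique (sym (concatMap-map≡cartesianProductWith (upTo t)))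
    (Unique.cartesianProductWith⁺ _∷_ Vec.∷-injective (Unique.upTo⁺ t) (tuples-unique t n))
  where
  concatMap-map≡cartesianProductWith : ∀ xs →
    concatMap (λ x → List.map (x ∷_) (tuples t n)) xs
      ≡ List.cartesianProductWith _∷_ xs (tuples t n)
  concatMap-map≡cartesianProductWith []       = refl
  concatMap-map≡cartesianProductWith (x ∷ xs) =
    cong (List.map (x ∷_) (tuples t n) List.++_) (concatMap-map≡cartesianProductWith xs)

Unique⇒lookup-injective : ∀ {A : Set} {xs : List A} → Unique xs →
  ∀ i j → List.lookup xs i ≡ List.lookup xs j → i ≡ j
Unique⇒lookup-injective (_  ∷ _) zero    zero    _  = refl
Unique⇒lookup-injective (x∉ ∷ _) zero    (suc j) eq = contradiction eq (All.lookup x∉ (∈-lookup j))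
Unique⇒lookup-injective (x∉ ∷ _) (suc i) zero    eq =
  contradiction (sym eq) (All.lookup x∉ (∈-lookup i))
Unique⇒lookup-injective (_  ∷ u) (suc i) (suc j) eq = cong suc (Unique⇒lookup-injective u i j eq)

sum<n⇒∃lookup≡0 : ∀ {n} (v : Vec ℕ n) → Vec.sum v < n → ∃ λ i → lookup v i ≡ 0
sum<n⇒∃lookup≡0 (zero  ∷ v) _          = zero , refl
sum<n⇒∃lookup≡0 (suc x ∷ v) (ℕ.s≤s lt) =
  let i , vᵢ≡0 = sum<n⇒∃lookup≡0 v (ℕ.≤-<-trans (ℕ.m≤n+m (Vec.sum v) x) lt)
  in suc i , vᵢ≡0

lookup-extensionality : ∀ {n} {u v : Vec ℕ n} → (∀ i → lookup u i ≡ lookup v i) → u ≡ v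
lookup-extensionality {u = u} {v} u≗v =
  trans (sym (Vec.tabulate∘lookup u)) (trans (Vec.tabulate-cong u≗v) (Vec.tabulate∘lookup v))

mono-self : ∀ {n} (e : Exp n) → mono e e ≡ 1ℚ
mono-self e = cong (if_then 1ℚ else 0ℚ) (dec-true (Vec.≡-dec ℕ._≟_ e e) refl)

mono-other : ∀ {n} {e f : Exp n} → e ≢ f → mono e f ≡ 0ℚ
mono-other {e = e} {f} e≢f =
  cong (if_then 1ℚ else 0ℚ) (dec-false (Vec.≡-dec ℕ._≟_ e f) e≢f)

module _ {n : ℕ} where

  expo-at : ∀ m (d : Vec ℕ n) i → lookup (expo m d i) i ≡ suc (2 ℕ.* lookup d i ℕ.+ m)
  expo-at m d i = trans (Vec.lookup∘tabulate _ i)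
    (cong (λ b → suc (2 ℕ.* lookup d i ℕ.+ (if b then m else 0))) (dec-true (i ≟ i) refl))

  expo-off : ∀ m (d : Vec ℕ n) {i x} → x ≢ i → lookup (expo m d i) x ≡ suc (2 ℕ.* lookup d x)
  expo-off m d {i} {x} x≢i = trans (Vec.lookup∘tabulate _ x) (cong suc (trans
    (cong (λ b → 2 ℕ.* lookup d x ℕ.+ (if b then m else 0)) (dec-false (x ≟ i) x≢i))
    (ℕ.+-identityʳ _)))

  -- For odd m the index i is recovered from expo m d i as its unique even entry.
  expo-odd-index : ∀ a a′ (d d′ : Vec ℕ n) i j →
    expo (suc (2 ℕ.* a′)) d′ i ≡ expo (suc (2 ℕ.* a)) d j → i ≡ j
  expo-odd-index a a′ d d′ i j eq with i ≟ j
  ... | yes i≡j = i≡j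
  ... | no  i≢j = contradiction even≡odd (ℕ.even≢odd (lookup d′ j) (lookup d j ℕ.+ a))
    where
    open ≡-Reasoning
    even≡odd : 2 ℕ.* lookup d′ j ≡ suc (2 ℕ.* (lookup d j ℕ.+ a))
    even≡odd = ℕ.suc-injective (begin
      suc (2 ℕ.* lookup d′ j)                    ≡⟨ expo-off _ d′ (i≢j ∘ sym) ⟨
      lookup (expo _ d′ i) j                     ≡⟨ cong (λ e → lookup e j) eq ⟩
      lookup (expo _ d j) j                      ≡⟨ expo-at _ d j ⟩
      suc (2 ℕ.* lookup d j ℕ.+ suc (2 ℕ.* a))   ≡⟨ cong suc (ℕ.+-suc _ _) ⟩
      suc (suc (2 ℕ.* lookup d j ℕ.+ 2 ℕ.* a))   ≡⟨ cong (λ x → suc (suc x)) (ℕ.*-distribˡ-+ 2 (lookup d j) a) ⟨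
      suc (suc (2 ℕ.* (lookup d j ℕ.+ a)))       ∎)

  expo-odd-diag : ∀ a a′ (d d′ : Vec ℕ n) i →
    expo (suc (2 ℕ.* a′)) d′ i ≡ expo (suc (2 ℕ.* a)) d i →
    lookup d′ i ℕ.+ a′ ≡ lookup d i ℕ.+ a
  expo-odd-diag a a′ d d′ i eq = ℕ.*-cancelˡ-≡ _ _ 2 (begin
    2 ℕ.* (lookup d′ i ℕ.+ a′)               ≡⟨ ℕ.*-distribˡ-+ 2 (lookup d′ i) a′ ⟩
    2 ℕ.* lookup d′ i ℕ.+ 2 ℕ.* a′           ≡⟨ ℕ.suc-injective (ℕ.suc-injective entries-at-i) ⟩
    2 ℕ.* lookup d i ℕ.+ 2 ℕ.* a             ≡⟨ sym (ℕ.*-distribˡ-+ 2 (lookup d i) a) ⟩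
    2 ℕ.* (lookup d i ℕ.+ a)                 ∎)
    where
    open ≡-Reasoning
    entries-at-i :
      suc (suc (2 ℕ.* lookup d′ i ℕ.+ 2 ℕ.* a′)) ≡ suc (suc (2 ℕ.* lookup d i ℕ.+ 2 ℕ.* a))
    entries-at-i = begin
      suc (suc (2 ℕ.* lookup d′ i ℕ.+ 2 ℕ.* a′))   ≡⟨ cong suc (ℕ.+-suc _ _) ⟨
      suc (2 ℕ.* lookup d′ i ℕ.+ suc (2 ℕ.* a′))   ≡⟨ expo-at _ d′ i ⟨
      lookup (expo _ d′ i) i                       ≡⟨ cong (λ e → lookup e i) eq ⟩
      lookup (expo _ d i) i                        ≡⟨ expo-at _ d i ⟩
      suc (2 ℕ.* lookup d i ℕ.+ suc (2 ℕ.* a))     ≡⟨ cong suc (ℕ.+-suc _ _) ⟩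
      suc (suc (2 ℕ.* lookup d i ℕ.+ 2 ℕ.* a))     ∎

  expo-off-agree : ∀ m m′ (d d′ : Vec ℕ n) {i x} →
    expo m′ d′ i ≡ expo m d i → x ≢ i → lookup d′ x ≡ lookup d x
  expo-off-agree m m′ d d′ {i} {x} eq x≢i = ℕ.*-cancelˡ-≡ _ _ 2 (ℕ.suc-injective
    (trans (sym (expo-off _ d′ x≢i)) (trans (cong (λ e → lookup e x) eq) (expo-off _ d x≢i))))

  expo-pivot-collision : ∀ a a′ (d d′ : Vec ℕ n) i i₀ → lookup d i₀ ≡ 0 → a ≤ a′ →
    expo (suc (2 ℕ.* a′)) d′ i ≡ expo (suc (2 ℕ.* a)) d i₀ → d′ ≡ d
  expo-pivot-collision a a′ d d′ i i₀ dᵢ₀≡0 a≤a′ eq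
    with refl ← expo-odd-index a a′ d d′ i i₀ eq = lookup-extensionality agree
    where
    d′ᵢ₀+a′≡a : lookup d′ i₀ ℕ.+ a′ ≡ a
    d′ᵢ₀+a′≡a = trans (expo-odd-diag a a′ d d′ i₀ eq) (cong (ℕ._+ a) dᵢ₀≡0)
    d′ᵢ₀≡0 : lookup d′ i₀ ≡ 0
    d′ᵢ₀≡0 = ℕ.n≤0⇒n≡0 (ℕ.+-cancelʳ-≤ a′ _ 0 (subst (_≤ a′) (sym d′ᵢ₀+a′≡a) a≤a′))
    agree : ∀ x → lookup d′ x ≡ lookup d x
    agree x with x ≟ i₀
    ... | yes refl = trans d′ᵢ₀≡0 (sym dᵢ₀≡0)
    ... | no  x≢i₀ = expo-off-agree _ _ d d′ eq x≢i₀

  gen≡sum : ∀ m (d : Vec ℕ n) e → gen m d e ≡ sum (λ i → mono (expo m d i) e)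
  gen≡sum m d e = Σℚ≡sum n _

  gen-vanishes : ∀ m (d : Vec ℕ n) {e} → (∀ i → expo m d i ≢ e) → gen m d e ≡ 0ℚ
  gen-vanishes m d {e} e∉ = trans (gen≡sum m d e) (sum-zero _ (λ i → mono-other (e∉ i)))

  gen-odd-at-own : ∀ a (d : Vec ℕ n) i → gen (suc (2 ℕ.* a)) d (expo (suc (2 ℕ.* a)) d i) ≡ 1ℚ
  gen-odd-at-own a d i = begin
    gen _ d (expo _ d i)                  ≡⟨ gen≡sum _ d _ ⟩
    sum (λ i′ → mono (expo _ d i′) _)     ≡⟨ sum-single _ i (λ i′ i′≢i → mono-other (i′≢i ∘ index i′)) ⟩
    mono (expo _ d i) (expo _ d i)        ≡⟨ mono-self (expo _ d i) ⟩
    1ℚ                                    ∎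
    where
    open ≡-Reasoning
    index : ∀ i′ → expo (suc (2 ℕ.* a)) d i′ ≡ expo (suc (2 ℕ.* a)) d i → i′ ≡ i
    index i′ = expo-odd-index a a d d i′ i

2[2+s]∸3≡1+2s : ∀ s → 2 ℕ.* suc (suc s) ∸ 3 ≡ suc (2 ℕ.* s)
2[2+s]∸3≡1+2s s = cong (_∸ 3) (trans (ℕ.*-suc 2 (suc s)) (cong (2 ℕ.+_) (ℕ.*-suc 2 s)))

odd-split : ∀ {s t} → t ≤ s → suc (2 ℕ.* (s ∸ t)) ℕ.+ 2 ℕ.* t ≡ suc (2 ℕ.* s)
odd-split {s} {t} t≤s =
  cong suc (trans (sym (ℕ.*-distribˡ-+ 2 (s ∸ t) t)) (cong (2 ℕ.*_) (ℕ.m∸n+n≡m t≤s)))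

odd-split⁻¹ : ∀ {s t} m → m ℕ.+ 2 ℕ.* t ≡ suc (2 ℕ.* s) → t ≤ s × m ≡ suc (2 ℕ.* (s ∸ t))
odd-split⁻¹ {s} {t} m eq = t≤s , ℕ.+-cancelʳ-≡ (2 ℕ.* t) _ _ (trans eq (sym (odd-split t≤s)))
  where
  t≤s : t ≤ s
  t≤s = ℕ.≤-pred (ℕ.*-cancelˡ-< 2 t (suc s) (begin-strict
    2 ℕ.* t                  ≤⟨ ℕ.m≤n+m _ m ⟩
    m ℕ.+ 2 ℕ.* t            ≡⟨ eq ⟩
    suc (2 ℕ.* s)            <⟨ ℕ.n<1+n _ ⟩
    2 ℕ.+ 2 ℕ.* s            ≡⟨ ℕ.*-suc 2 s ⟨
    2 ℕ.* suc s              ∎))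
    where open ℕ.≤-Reasoning

module Basis (s n : ℕ) where

  degrees : List (Vec ℕ n)
  degrees = filter (λ v → Vec.sum v <? suc s) (tuples (suc s) n)

  -- M (suc s) n is by definition the length of degrees.
  d : Fin (M (suc s) n) → Vec ℕ n
  d = List.lookup degrees

  a : Fin (M (suc s) n) → ℕ
  a j = s ∸ Vec.sum (d j)

  basis : Fin (M (suc s) n) → Poly n
  basis j = gen (suc (2 ℕ.* a j)) (d j)

  d-injective : ∀ l j → d l ≡ d j → l ≡ j
  d-injective = Unique⇒lookup-injective (Unique.filter⁺ _ (tuples-unique (suc s) n))

  sum-d≤s : ∀ j → Vec.sum (d j) ≤ s
  sum-d≤s j =
    ℕ.≤-pred (proj₂ (∈-filter⁻ (λ v → Vec.sum v <? suc s) {xs = tuples (suc s) n} (∈-lookup j)))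

  basis∈W : ∀ j → basis j ∈W[ suc (suc s) ]
  basis∈W j = genOf∈W (suc (suc s))
    (suc (2 ℕ.* a j) , d j , trans (odd-split (sum-d≤s j)) (sym (2[2+s]∸3≡1+2s s)))

  generator⇒basis : (g : GenIdx (suc (suc s)) n) →
    ∃ λ j → ∀ e → genOf {suc (suc s)} g e ≡ basis j e
  generator⇒basis (m , v , constraint) = j , λ e → cong₂ (λ m′ v′ → gen m′ v′ e) m≡ v≡dj
    where
    split : Vec.sum v ≤ s × m ≡ suc (2 ℕ.* (s ∸ Vec.sum v))
    split = odd-split⁻¹ m (trans constraint (2[2+s]∸3≡1+2s s))
    sum-v<1+s : Vec.sum v < suc s
    sum-v<1+s = ℕ.s≤s (proj₁ split)
    v∈degrees : v ∈ degrees
    v∈degrees = ∈-filter⁺ (λ u → Vec.sum u <? suc s) (∈-tuples v sum-v<1+s) sum-v<1+s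
    j : Fin (M (suc s) n)
    j = Any.index v∈degrees
    v≡dj : v ≡ d j
    v≡dj = lookup-index v∈degrees
    m≡ : m ≡ suc (2 ℕ.* a j)
    m≡ = trans (proj₂ split) (cong (λ u → suc (2 ℕ.* (s ∸ Vec.sum u))) v≡dj)

  basis-linIndep : s < n → LinIndep basis
  basis-linIndep s<n = unitriangular⇒linIndep basis a pivot
    (λ j → gen-odd-at-own (a j) (d j) (i₀ j))
    (λ j l l≢j aj≤al → gen-vanishes _ (d l)
      (λ i eq → l≢j (d-injective l j
        (expo-pivot-collision (a j) (a l) (d j) (d l) i (i₀ j) (dᵢ₀≡0 j) aj≤al eq))))
    where
    zero-entry : ∀ j → ∃ λ i → lookup (d j) i ≡ 0
    zero-entry j = sum<n⇒∃lookup≡0 (d j) (ℕ.≤-<-trans (sum-d≤s j) s<n)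
    i₀ : Fin (M (suc s) n) → Fin n
    i₀ j = proj₁ (zero-entry j)
    dᵢ₀≡0 : ∀ j → lookup (d j) (i₀ j) ≡ 0
    dᵢ₀≡0 j = proj₂ (zero-entry j)
    pivot : Fin (M (suc s) n) → Exp n
    pivot j = expo (suc (2 ℕ.* a j)) (d j) (i₀ j)

corollary2p8 : (k n : ℕ) → 2 ≤ k → k ∸ 1 ≤ n → HasDimW k n (M (k ∸ 1) n)
corollary2p8 (suc zero) n (ℕ.s≤s ()) _
corollary2p8 (suc (suc s)) n _ s<n =
  basis , basis∈W , basis-linIndep s<n , λ P (cs , P≡cs) →
    let c , cs≡c = lincomb⇒combo (suc (suc s)) basis generator⇒basis cs
    in c , λ e → trans (P≡cs e) (cs≡c e)
  where open Basis s n
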